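{- Let $F$ be a $3$-graph. Every minimum semi-layered function of $F$ is a layered function of $F$.
   Context: A $3$-graph is a $3$-uniform hypergraph. For $f:V(F)\to\mathbb{N}$ consider the conditions: (A1) in each edge exactly one vertex has label strictly greater than the other two; (A2) if two edges $uvw$, $u'v'w'$ satisfy $\max\{f(u),f(v),f(w)\}=\max\{f(u'),f(v'),f(w')\}$, then the multisets $\{f(u),f(v),f(w)\}$ and $\{f(u'),f(v'),f(w')\}$ are equal; (A3) if two edges $uvw$, $u'v'w'$ satisfy $f(u)=f(u')$ and $f(v)=f(v')$, then $f(w)=f(w')$. $f$ is a layered function if it satisfies (A1)–(A3), and a semi-layered function if it satisfies (A1) and (A2). The cardinality of $f$ is the size of its range; a semi-layered function is minimum if its cardinality is minimum among all semi-layered functions of $F$. -}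

module Defs where

open import Data.Nat using (ℕ; _<_; _≤_; _⊔_; _≟_)
open import Data.Fin using (Fin)
open import Data.List using (List; []; _∷_; map; length; deduplicate)
open import Data.List.Membership.Propositional using (_∈_)
open import Data.List.Relation.Binary.Permutation.Propositional using (_↭_)
open import Data.List.Relation.Unary.All using (All)
open import Data.Product using (_×_; _,_)
open import Data.Sum using (_⊎_)
open import Relation.Binary.PropositionalEquality using (_≡_; _≢_)
open import Relation.Nullary using (¬_)
import Data.Fin as F
import Data.List as L

-- A (finite) 3-graph on vertex set Fin n: a list of edges, each given as a
-- triple of pairwise distinct vertices (an edge is the unordered set {u,v,w}).
record ThreeGraph : Set where
  field
    n        : ℕ
    edges    : List (Fin n × Fin n × Fin n)
    distinct : All (λ { (u , v , w) → (u ≢ v) × (u ≢ w) × (v ≢ w) }) edges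

open ThreeGraph public

IsEdge : (F : ThreeGraph) → Fin (n F) → Fin (n F) → Fin (n F) → Set
IsEdge F u v w =
  ((u , v , w) ∈ edges F) ⊎ ((u , w , v) ∈ edges F) ⊎ ((v , u , w) ∈ edges F) ⊎
  ((v , w , u) ∈ edges F) ⊎ ((w , u , v) ∈ edges F) ⊎ ((w , v , u) ∈ edges F)

Labeling : ThreeGraph → Set
Labeling F = Fin (n F) → ℕ

max3 : ℕ → ℕ → ℕ → ℕ
max3 a b c = a ⊔ b ⊔ c

-- "exactly one of a, b, c is strictly greater than the other two"
-- (the three alternatives are automatically mutually exclusive).
UniqueMax : ℕ → ℕ → ℕ → Set
UniqueMax a b c = (b < a × c < a) ⊎ (a < b × c < b) ⊎ (a < c × b < c)

A1 : (F : ThreeGraph) → Labeling F → Set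
A1 F f = ∀ u v w → IsEdge F u v w → UniqueMax (f u) (f v) (f w)

A2 : (F : ThreeGraph) → Labeling F → Set
A2 F f = ∀ u v w u' v' w' → IsEdge F u v w → IsEdge F u' v' w' →
  max3 (f u) (f v) (f w) ≡ max3 (f u') (f v') (f w') →
  (f u ∷ f v ∷ f w ∷ []) ↭ (f u' ∷ f v' ∷ f w' ∷ [])

A3 : (F : ThreeGraph) → Labeling F → Set
A3 F f = ∀ u v w u' v' w' → IsEdge F u v w → IsEdge F u' v' w' →
  f u ≡ f u' → f v ≡ f v' → f w ≡ f w'

IsLayered : (F : ThreeGraph) → Labeling F → Set
IsLayered F f = A1 F f × A2 F f × A3 F f

IsSemiLayered : (F : ThreeGraph) → Labeling F → Set
IsSemiLayered F f = A1 F f × A2 F f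

cardinality : (F : ThreeGraph) → Labeling F → ℕ
cardinality F f = length (deduplicate _≟_ (map f (L.allFin (n F))))

IsMinimumSemiLayered : (F : ThreeGraph) → Labeling F → Set
IsMinimumSemiLayered F f =
  IsSemiLayered F f × (∀ (g : Labeling F) → IsSemiLayered F g → cardinality F f ≤ cardinality F g)

-- Let f be a minimum semi-layered function and let uvw, u'v'w' be edges with
-- f u = f u' and f v = f v'. If their peaks (largest labels) agree, (A2) makes
-- their label multisets equal, so f w = f w'. Otherwise, say the peak of uvw is
-- smaller; then the peak of u'v'w' is f w', and by (A2) every edge with that
-- peak carries the labels {f u, f v, f w'}. Relabel the value f w' as f w. The
-- edges of that class now carry the labels of uvw, and every other edge keeps
-- its peak while its other labels can only decrease. So every edge looks like
-- an edge whose peak was not touched, (A1) and (A2) survive, and the new labeling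
-- is semi-layered with one label fewer, contradicting minimality.
module Submission where

open import Defs
open import Data.Nat
open import Data.Nat.Properties
open import Data.Fin using (Fin)
open import Data.Empty using (⊥-elim)
open import Data.Product using (_×_; _,_; ∃; proj₁; proj₂)
open import Data.Sum using (_⊎_; inj₁; inj₂)
open import Function using (_∘_)
open import Data.List using (List; []; _∷_; map; length; deduplicate; filter; allFin)
open import Data.List.Properties using (length-map; map-∘; filter-notAll; ∷-injectiveˡ)
open import Data.List.Membership.Propositional using (_∈_)
open import Data.List.Membership.Propositional.Properties
  using (∈-map⁺; ∈-map⁻; ∈-filter⁺; ∈-deduplicate⁺; ∈-deduplicate⁻; ∈-allFin)
open import Data.List.Relation.Unary.Any using (here; there)
import Data.List.Relation.Unary.Any as Any
import Data.List.Relation.Unary.All as All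
import Data.List.Relation.Unary.AllPairs as AllPairs
open import Data.List.Relation.Unary.Unique.Propositional using (Unique)
import Data.List.Relation.Unary.Unique.DecPropositional.Properties as UniqueDec
open import Data.List.Relation.Binary.Subset.Propositional using (_⊆_)
open import Data.List.Relation.Binary.Permutation.Propositional using (_↭_; ↭-refl; ↭-sym; ↭-trans)
open import Data.List.Relation.Binary.Permutation.Propositional.Properties
  using (map⁺; ∈-resp-↭; drop-mid; ↭-singleton-inv)
open import Relation.Binary.Definitions using (DecidableEquality; tri<; tri≈; tri>)
open import Relation.Binary.PropositionalEquality using (_≡_; _≢_; refl; sym; trans; cong; cong₂; subst; module ≡-Reasoning)
open import Relation.Nullary using (¬_; yes; no; ¬?)

module _ {a} {A : Set a} (_≟_ : DecidableEquality A) where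

  Unique-⊆⇒length-≤ : ∀ {xs ys : List A} → Unique xs → xs ⊆ ys → length xs ≤ length ys
  Unique-⊆⇒length-≤ {[]} _ _ = z≤n
  Unique-⊆⇒length-≤ {x ∷ xs} {ys} (x∉xs AllPairs.∷ xs!) x∷xs⊆ys =
    <-≤-trans (s≤s (Unique-⊆⇒length-≤ xs! xs⊆ys-x)) (filter-notAll P? ys x∈ys)
    where
    P? = λ y → ¬? (y ≟ x)
    x∈ys = Any.map (λ { refl ¬x≢x → ¬x≢x refl }) (x∷xs⊆ys (here refl))
    xs⊆ys-x : xs ⊆ filter P? ys
    xs⊆ys-x y∈xs = ∈-filter⁺ P? (x∷xs⊆ys (there y∈xs)) (λ y≡x → All.lookup x∉xs y∈xs (sym y≡x))

module _ {a b} {A : Set a} {B : Set b} (_≟ᴬ_ : DecidableEquality A) (_≟ᴮ_ : DecidableEquality B) where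

  length-deduplicate-map-< : (h : A → B) (xs : List A) {x y : A} → x ∈ xs → y ∈ xs →
    x ≢ y → h x ≡ h y → length (deduplicate _≟ᴮ_ (map h xs)) < length (deduplicate _≟ᴬ_ xs)
  length-deduplicate-map-< h xs {x} {y} x∈xs y∈xs x≢y hx≡hy = begin-strict
    length (deduplicate _≟ᴮ_ (map h xs))
      ≤⟨ Unique-⊆⇒length-≤ _≟ᴮ_ (UniqueDec.deduplicate-! _≟ᴮ_ (map h xs)) image⊆ ⟩
    length (map h rest)
      ≡⟨ length-map h rest ⟩
    length rest
      <⟨ filter-notAll P? dedup x∈dedup ⟩
    length dedup
      ∎
    where
    open ≤-Reasoning
    dedup = deduplicate _≟ᴬ_ xs
    P? = λ z → ¬? (z ≟ᴬ x)
    rest = filter P? dedup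
    x∈dedup = Any.map (λ { refl ¬x≢x → ¬x≢x refl }) (∈-deduplicate⁺ _≟ᴬ_ x∈xs)
    image⊆ : deduplicate _≟ᴮ_ (map h xs) ⊆ map h rest
    image⊆ z∈ with ∈-map⁻ h (∈-deduplicate⁻ _≟ᴮ_ (map h xs) z∈)
    ... | z , z∈xs , refl with z ≟ᴬ x
    ...   | yes refl = subst (_∈ map h rest) (sym hx≡hy)
                         (∈-map⁺ h (∈-filter⁺ P? (∈-deduplicate⁺ _≟ᴬ_ y∈xs) (x≢y ∘ sym)))
    ...   | no z≢x   = ∈-map⁺ h (∈-filter⁺ P? (∈-deduplicate⁺ _≟ᴬ_ z∈xs) z≢x)

cardinality-∘-< : (F : ThreeGraph) (f : Labeling F) (h : ℕ → ℕ) {x y : Fin (n F)} →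
  f x ≢ f y → h (f x) ≡ h (f y) → cardinality F (h ∘ f) < cardinality F f
cardinality-∘-< F f h {x} {y} fx≢fy hfx≡hfy =
  subst (λ ys → length (deduplicate _≟_ ys) < cardinality F f) (sym (map-∘ vertices))
    (length-deduplicate-map-< _≟_ _≟_ h (map f vertices)
      (∈-map⁺ f (∈-allFin x)) (∈-map⁺ f (∈-allFin y)) fx≢fy hfx≡hfy)
  where vertices = allFin (n F)

data Permutation₃ (a b c : ℕ) : ℕ → ℕ → ℕ → Set where
  abc : Permutation₃ a b c a b c
  acb : Permutation₃ a b c a c b
  bac : Permutation₃ a b c b a c
  bca : Permutation₃ a b c b c a
  cab : Permutation₃ a b c c a b
  cba : Permutation₃ a b c c b a

↭-pair : ∀ {b c y z : ℕ} → (b ∷ c ∷ []) ↭ (y ∷ z ∷ []) → (b ≡ y × c ≡ z) ⊎ (b ≡ z × c ≡ y)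
↭-pair {y = y} p with ∈-resp-↭ p (here refl)
... | here refl         = inj₁ (refl , ∷-injectiveˡ (↭-singleton-inv (drop-mid [] [] p)))
... | there (here refl) = inj₂ (refl , ∷-injectiveˡ (↭-singleton-inv (drop-mid [] (y ∷ []) p)))

↭⇒Permutation₃ : ∀ {a b c x y z : ℕ} → (a ∷ b ∷ c ∷ []) ↭ (x ∷ y ∷ z ∷ []) → Permutation₃ a b c x y z
↭⇒Permutation₃ {x = x} {y} p with ∈-resp-↭ p (here refl)
... | here refl with ↭-pair (drop-mid [] [] p)
...   | inj₁ (refl , refl) = abc
...   | inj₂ (refl , refl) = acb
↭⇒Permutation₃ {x = x} {y} p | there (here refl) with ↭-pair (drop-mid [] (x ∷ []) p)
...   | inj₁ (refl , refl) = bac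
...   | inj₂ (refl , refl) = cab
↭⇒Permutation₃ {x = x} {y} p | there (there (here refl)) with ↭-pair (drop-mid [] (x ∷ y ∷ []) p)
...   | inj₁ (refl , refl) = bca
...   | inj₂ (refl , refl) = cba

↭-cancel-pair : ∀ {a b c a' b' c' : ℕ} → a ≡ a' → b ≡ b' →
  (a ∷ b ∷ c ∷ []) ↭ (a' ∷ b' ∷ c' ∷ []) → c ≡ c'
↭-cancel-pair refl refl p = ∷-injectiveˡ (↭-singleton-inv (drop-mid [] [] (drop-mid [] [] p)))

UniqueMax-swap₁₂ : ∀ {a b c} → UniqueMax a b c → UniqueMax b a c
UniqueMax-swap₁₂ (inj₁ m)                 = inj₂ (inj₁ m)
UniqueMax-swap₁₂ (inj₂ (inj₁ m))          = inj₁ m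
UniqueMax-swap₁₂ (inj₂ (inj₂ (a<c , b<c))) = inj₂ (inj₂ (b<c , a<c))

UniqueMax-swap₂₃ : ∀ {a b c} → UniqueMax a b c → UniqueMax a c b
UniqueMax-swap₂₃ (inj₁ (b<a , c<a)) = inj₁ (c<a , b<a)
UniqueMax-swap₂₃ (inj₂ (inj₁ m))    = inj₂ (inj₂ m)
UniqueMax-swap₂₃ (inj₂ (inj₂ m))    = inj₂ (inj₁ m)

UniqueMax-resp-↭ : ∀ {a b c x y z} → (a ∷ b ∷ c ∷ []) ↭ (x ∷ y ∷ z ∷ []) →
  UniqueMax a b c → UniqueMax x y z
UniqueMax-resp-↭ p with ↭⇒Permutation₃ p
... | abc = λ m → m
... | acb = UniqueMax-swap₂₃
... | bac = UniqueMax-swap₁₂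
... | bca = UniqueMax-swap₂₃ ∘ UniqueMax-swap₁₂
... | cab = UniqueMax-swap₁₂ ∘ UniqueMax-swap₂₃
... | cba = UniqueMax-swap₁₂ ∘ UniqueMax-swap₂₃ ∘ UniqueMax-swap₁₂

∈⇒≤max3 : ∀ {x a b c} → x ∈ (a ∷ b ∷ c ∷ []) → x ≤ max3 a b c
∈⇒≤max3 {a = a} {b} {c} (here refl)                 = ≤-trans (m≤m⊔n a b) (m≤m⊔n (a ⊔ b) c)
∈⇒≤max3 {a = a} {b} {c} (there (here refl))         = ≤-trans (m≤n⊔m a b) (m≤m⊔n (a ⊔ b) c)
∈⇒≤max3 {a = a} {b} {c} (there (there (here refl))) = m≤n⊔m (a ⊔ b) c

max3∈ : ∀ a b c → max3 a b c ∈ (a ∷ b ∷ c ∷ [])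
max3∈ a b c with ⊔-sel (a ⊔ b) c | ⊔-sel a b
... | inj₂ m≡c  | _         = subst (_∈ (a ∷ b ∷ c ∷ [])) (sym m≡c) (there (there (here refl)))
... | inj₁ m≡ab | inj₁ ab≡a = subst (_∈ (a ∷ b ∷ c ∷ [])) (sym (trans m≡ab ab≡a)) (here refl)
... | inj₁ m≡ab | inj₂ ab≡b = subst (_∈ (a ∷ b ∷ c ∷ [])) (sym (trans m≡ab ab≡b)) (there (here refl))

max3-resp-↭ : ∀ {a b c x y z} → (a ∷ b ∷ c ∷ []) ↭ (x ∷ y ∷ z ∷ []) → max3 a b c ≡ max3 x y z
max3-resp-↭ {a} {b} {c} {x} {y} {z} p = ≤-antisym
  (∈⇒≤max3 (∈-resp-↭ p (max3∈ a b c))) (∈⇒≤max3 (∈-resp-↭ (↭-sym p) (max3∈ x y z)))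

max3-first : ∀ {a b c} → b < a → c < a → max3 a b c ≡ a
max3-first {a} {b} {c} b<a c<a = trans (cong (_⊔ c) (m≥n⇒m⊔n≡m (<⇒≤ b<a))) (m≥n⇒m⊔n≡m (<⇒≤ c<a))

max3-second : ∀ {a b c} → a < b → c < b → max3 a b c ≡ b
max3-second {a} {b} {c} a<b c<b = trans (cong (_⊔ c) (m≤n⇒m⊔n≡n (<⇒≤ a<b))) (m≥n⇒m⊔n≡m (<⇒≤ c<b))

max3-third : ∀ {a b c} → a < c → b < c → max3 a b c ≡ c
max3-third a<c b<c = m≤n⇒m⊔n≡n (⊔-lub (<⇒≤ a<c) (<⇒≤ b<c))

max3-exceeding : ∀ {a b c m} → a ⊔ b ≤ m → m < max3 a b c → max3 a b c ≡ c
max3-exceeding {a} {b} {c} ab≤m m<max with ⊔-sel (a ⊔ b) c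
... | inj₁ max≡ab = ⊥-elim (<⇒≱ m<max (subst (_≤ _) (sym max≡ab) ab≤m))
... | inj₂ max≡c  = max≡c

Deflationary : (ℕ → ℕ) → Set
Deflationary h = ∀ y → h y ≤ y

module _ {h : ℕ → ℕ} (h-deflationary : Deflationary h) {a b c : ℕ}
         (h-fixes-max : h (max3 a b c) ≡ max3 a b c) where

  max3-deflate : max3 (h a) (h b) (h c) ≡ max3 a b c
  max3-deflate = ≤-antisym
    (⊔-mono-≤ (⊔-mono-≤ (h-deflationary a) (h-deflationary b)) (h-deflationary c))
    (subst (_≤ max3 (h a) (h b) (h c)) h-fixes-max (∈⇒≤max3 (∈-map⁺ h (max3∈ a b c))))

  private
    below-fixed : ∀ {m y} → max3 a b c ≡ m → y < m → h y < h m
    below-fixed refl y<m = subst (_ <_) (sym h-fixes-max) (≤-<-trans (h-deflationary _) y<m)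

  UniqueMax-deflate : UniqueMax a b c → UniqueMax (h a) (h b) (h c)
  UniqueMax-deflate (inj₁ (b<a , c<a)) =
    inj₁ (below-fixed (max3-first b<a c<a) b<a , below-fixed (max3-first b<a c<a) c<a)
  UniqueMax-deflate (inj₂ (inj₁ (a<b , c<b))) =
    inj₂ (inj₁ (below-fixed (max3-second a<b c<b) a<b , below-fixed (max3-second a<b c<b) c<b))
  UniqueMax-deflate (inj₂ (inj₂ (a<c , b<c))) =
    inj₂ (inj₂ (below-fixed (max3-third a<c b<c) a<c , below-fixed (max3-third a<c b<c) b<c))

replace : ℕ → ℕ → ℕ → ℕ
replace m z y with y ≟ m
... | yes _ = z
... | no _  = y

replace-≡ : ∀ m z → replace m z m ≡ z
replace-≡ m z with m ≟ m
... | yes _   = refl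
... | no m≢m = ⊥-elim (m≢m refl)

replace-≢ : ∀ {m z y} → y ≢ m → replace m z y ≡ y
replace-≢ {m} {z} {y} y≢m with y ≟ m
... | yes y≡m = ⊥-elim (y≢m y≡m)
... | no _    = refl

replace-deflationary : ∀ {m z} → z ≤ m → Deflationary (replace m z)
replace-deflationary {m} z≤m y with y ≟ m
... | yes refl = z≤m
... | no _     = ≤-refl

Triple : ℕ → Set
Triple k = Fin k × Fin k × Fin k

Edge : (F : ThreeGraph) → Triple (n F) → Set
Edge F (u , v , w) = IsEdge F u v w

labels : ∀ {k} → (Fin k → ℕ) → Triple k → List ℕ
labels f (u , v , w) = f u ∷ f v ∷ f w ∷ []

peak : ∀ {k} → (Fin k → ℕ) → Triple k → ℕ
peak f (u , v , w) = max3 (f u) (f v) (f w)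

module Collapse (F : ThreeGraph) (f : Labeling F) (semi : IsSemiLayered F f)
  {u v w u' v' w' : Fin (n F)} (e : IsEdge F u v w) (e' : IsEdge F u' v' w')
  (u≡u' : f u ≡ f u') (v≡v' : f v ≡ f v')
  (peak< : peak f (u , v , w) < peak f (u' , v' , w')) where

  private
    A1f = proj₁ semi
    A2f = proj₂ semi

  top : ℕ
  top = f w'

  labels≤peak : ∀ {x} → x ∈ labels f (u , v , w) → x ≤ peak f (u , v , w)
  labels≤peak = ∈⇒≤max3

  peak′≡top : peak f (u' , v' , w') ≡ top
  peak′≡top = max3-exceeding {f u'} {f v'}
    (⊔-lub (subst (_≤ peak f (u , v , w)) u≡u' (labels≤peak (here refl)))
           (subst (_≤ peak f (u , v , w)) v≡v' (labels≤peak (there (here refl)))))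
    peak<

  peak<top : peak f (u , v , w) < top
  peak<top = subst (peak f (u , v , w) <_) peak′≡top peak<

  w<top : f w < top
  w<top = ≤-<-trans (labels≤peak (there (there (here refl)))) peak<top

  collapse : ℕ → ℕ
  collapse = replace top (f w)

  collapsed : Labeling F
  collapsed = collapse ∘ f

  collapse-deflationary : Deflationary collapse
  collapse-deflationary = replace-deflationary (<⇒≤ w<top)

  Untouched : Triple (n F) → Set
  Untouched t = peak f t ≢ top

  top-class : ∀ {t} → Edge F t → peak f t ≡ top → labels collapsed t ↭ labels collapsed (u , v , w)
  top-class {p , q , r} ep peak≡top =
    subst (labels collapsed (p , q , r) ↭_) e′↦e
      (map⁺ collapse (A2f p q r u' v' w' ep e' (trans peak≡top (sym peak′≡top))))
    where
    e′↦e : map collapse (labels f (u' , v' , w')) ≡ labels collapsed (u , v , w)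
    e′↦e = cong₂ _∷_ (cong collapse (sym u≡u'))
             (cong₂ _∷_ (cong collapse (sym v≡v'))
               (cong (_∷ []) (trans (replace-≡ top (f w)) (sym (replace-≢ (<⇒≢ w<top))))))

  representative : ∀ {t} → Edge F t →
    ∃ λ t₀ → Edge F t₀ × Untouched t₀ × labels collapsed t ↭ labels collapsed t₀
  representative {t} et with peak f t ≟ top
  ... | yes peak≡top = (u , v , w) , e , <⇒≢ peak<top , top-class et peak≡top
  ... | no  peak≢top = t , et , peak≢top , ↭-refl

  untouched-peak : ∀ t → Untouched t → peak collapsed t ≡ peak f t
  untouched-peak (p , q , r) peak≢top =
    max3-deflate collapse-deflationary {f p} {f q} {f r} (replace-≢ peak≢top)

  A1-collapsed : A1 F collapsed
  A1-collapsed p q r ep with representative {p , q , r} ep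
  ... | (p₀ , q₀ , r₀) , e₀ , peak≢top , ↭₀ =
    UniqueMax-resp-↭ (↭-sym ↭₀)
      (UniqueMax-deflate collapse-deflationary {f p₀} {f q₀} {f r₀} (replace-≢ peak≢top)
        (A1f p₀ q₀ r₀ e₀))

  A2-collapsed : A2 F collapsed
  A2-collapsed p q r p' q' r' ep ep' peak≡peak′
    with representative {p , q , r} ep | representative {p' , q' , r'} ep'
  ... | t₀@(p₀ , q₀ , r₀) , e₀ , ≢₀ , ↭₀ | t₁@(p₁ , q₁ , r₁) , e₁ , ≢₁ , ↭₁ =
    ↭-trans ↭₀ (↭-trans (map⁺ collapse (A2f p₀ q₀ r₀ p₁ q₁ r₁ e₀ e₁ peak₀≡peak₁)) (↭-sym ↭₁))
    where
    open ≡-Reasoning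
    peak₀≡peak₁ : peak f t₀ ≡ peak f t₁
    peak₀≡peak₁ = begin
      peak f t₀                     ≡⟨ untouched-peak t₀ ≢₀ ⟨
      peak collapsed t₀             ≡⟨ max3-resp-↭ ↭₀ ⟨
      peak collapsed (p , q , r)    ≡⟨ peak≡peak′ ⟩
      peak collapsed (p' , q' , r') ≡⟨ max3-resp-↭ ↭₁ ⟩
      peak collapsed t₁             ≡⟨ untouched-peak t₁ ≢₁ ⟩
      peak f t₁                     ∎

  collapsed-semiLayered : IsSemiLayered F collapsed
  collapsed-semiLayered = A1-collapsed , A2-collapsed

  cardinality-collapsed-< : cardinality F collapsed < cardinality F f
  cardinality-collapsed-< = cardinality-∘-< F f collapse {w'} {w}
    (<⇒≢ w<top ∘ sym) (trans (replace-≡ top (f w)) (sym (replace-≢ (<⇒≢ w<top))))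

module _ {F : ThreeGraph} {f : Labeling F} (minimum : IsMinimumSemiLayered F f) where

  minimum⇒peak≮ : ∀ {u v w u' v' w'} (e : IsEdge F u v w) (e' : IsEdge F u' v' w') →
    f u ≡ f u' → f v ≡ f v' → ¬ (peak f (u , v , w) < peak f (u' , v' , w'))
  minimum⇒peak≮ e e' u≡u' v≡v' peak< =
    <⇒≱ cardinality-collapsed-< (proj₂ minimum collapsed collapsed-semiLayered)
    where open Collapse F f (proj₁ minimum) e e' u≡u' v≡v' peak<

  minimum⇒A3 : A3 F f
  minimum⇒A3 u v w u' v' w' e e' u≡u' v≡v' with <-cmp (peak f (u , v , w)) (peak f (u' , v' , w'))
  ... | tri< peak< _ _ = ⊥-elim (minimum⇒peak≮ e e' u≡u' v≡v' peak<)
  ... | tri≈ _ peak≡ _ = ↭-cancel-pair u≡u' v≡v' (proj₂ (proj₁ minimum) u v w u' v' w' e e' peak≡)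
  ... | tri> _ _ peak> = ⊥-elim (minimum⇒peak≮ e' e (sym u≡u') (sym v≡v') peak>)

proposition4p1 : (F : ThreeGraph) (f : Labeling F) →
    IsMinimumSemiLayered F f → IsLayered F f
proposition4p1 F f minimum@((A1f , A2f) , _) = A1f , A2f , minimum⇒A3 {F} {f} minimum
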